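{- A formula $f$ satisfies $AE(f)>1$ if and only if there exists a nice formula $g$ such that $g\preceq f$.
   Context: Variables are letters of an alphabet $\Delta=\{A,B,C,\dots\}$. A formula is a finite set of non-empty words over $\Delta$, called fragments, written separated by dots. A formula $g$ is nice if for every variable $X$ of $g$ there is a fragment of $g$ containing $X$ at least twice. An occurrence of a formula $f$ in a word $w$ over an alphabet $\Sigma$ is a non-erasing morphism $h:\Delta^*\to\Sigma^*$ such that $h(\phi)$ is a factor of $w$ for every fragment $\phi$ of $f$; $w$ avoids $f$ if it has no occurrence of $f$. We write $g\preceq f$ if there is a non-erasing morphism $h$ such that the $h$-image of every fragment of $g$ is a factor of some fragment of $f$. The exponent of a non-empty word $u$ is $|u|/p$ with $p$ the smallest period of $u$; a word is $\alpha$-free if it has no factor of exponent at least $\alpha$. The avoidability exponent $AE(f)$ is the largest (supremum) real $\alpha$ such that every $\alpha$-free word over any finite alphabet avoids $f$. -}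

module Defs where

open import Data.Nat using (ℕ; zero; suc; _+_; _<_; _≤_; NonZero)
open import Data.Fin using (Fin)
open import Data.List using (List; []; _∷_; _++_; length; concatMap; filter)
open import Data.List.NonEmpty using (List⁺; toList)
open import Data.List.Membership.Propositional using (_∈_)
open import Data.Maybe using (Maybe; just; nothing)
open import Data.Product using (Σ; ∃; _×_; _,_)
open import Data.Integer using (+_)
open import Data.Rational using (ℚ; _/_) renaming (_≤_ to _≤ℚ_)
open import Relation.Binary.PropositionalEquality using (_≡_)
open import Relation.Nullary using (¬_)

Var : Set
Var = ℕ

-- A fragment is a non-empty word over Δ; a formula is a finite
-- (non-empty) set of fragments, represented as a non-empty list.
Fragment : Set
Fragment = List⁺ Var

Formula : Set
Formula = List⁺ Fragment

fragments : Formula → List Fragment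
fragments f = toList f

Factor : {A : Set} → List A → List A → Set
Factor {A} u w = Σ (List A) λ x → Σ (List A) λ y → x ++ u ++ y ≡ w

Morphism : Set → Set
Morphism B = Var → List⁺ B

applyM : {B : Set} → Morphism B → List Var → List B
applyM h = concatMap (λ X → toList (h X))

IsOccurrence : {k : ℕ} → Formula → List (Fin k) → Morphism (Fin k) → Set
IsOccurrence f w h = ∀ φ → φ ∈ fragments f → Factor (applyM h (toList φ)) w

Avoids : {k : ℕ} → List (Fin k) → Formula → Set
Avoids {k} w f = ¬ (Σ (Morphism (Fin k)) λ h → IsOccurrence f w h)

count : Var → List Var → ℕ
count X [] = 0
count X (Y ∷ ys) with X Data.Nat.≟ Y
... | Relation.Nullary.yes _ = suc (count X ys)
... | Relation.Nullary.no _ = count X ys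

OccursIn : Var → Formula → Set
OccursIn X f = Σ Fragment λ φ → φ ∈ fragments f × X ∈ toList φ

Nice : Formula → Set
Nice g = ∀ X → OccursIn X g →
  Σ Fragment λ φ → φ ∈ fragments g × 2 ≤ count X (toList φ)

_≼_ : Formula → Formula → Set
g ≼ f = Σ (Morphism Var) λ h →
  ∀ φ → φ ∈ fragments g → Σ Fragment λ ψ → ψ ∈ fragments f ×
    Factor (applyM h (toList φ)) (toList ψ)

at : {A : Set} → List A → ℕ → Maybe A
at [] _ = nothing
at (x ∷ xs) zero = just x
at (x ∷ xs) (suc i) = at xs i

IsPeriod : {A : Set} → List A → ℕ → Set
IsPeriod u p = 1 ≤ p × (∀ i → i + p < length u → at u i ≡ at u (i + p))

IsSmallestPeriod : {A : Set} → List A → ℕ → Set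
IsSmallestPeriod u p = IsPeriod u p × (∀ q → q < p → ¬ IsPeriod u q)

ExponentAtLeast : {A : Set} → ℚ → List A → Set
ExponentAtLeast α u = 1 ≤ length u × Σ ℕ λ p →
  IsSmallestPeriod u (suc p) × α ≤ℚ ((+ length u) / suc p)

Free : {A : Set} → ℚ → List A → Set
Free α w = ∀ u → Factor u w → ¬ ExponentAtLeast α u

-- "AE(f) > 1": since the set of α such that every α-free word over every
-- finite alphabet avoids f is downward closed, its supremum exceeds 1 iff
-- it contains some (rational) α > 1.
AEGreaterThanOne : Formula → Set
AEGreaterThanOne f = Σ ℚ λ α → Data.Rational._<_ (Data.Rational.1ℚ) α ×
  (∀ (k : ℕ) (w : List (Fin k)) → Free α w → Avoids w f)

module Submission where

-- If a nice g divides f, an occurrence of f gives one of g. Take a variable X of g with a longest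
-- image and a fragment of g containing X twice, …X v X…: the image h(X) h(v) h(X) has period
-- |h(X v)| and |h(v)| ≤ M |h(X)|, M the longest fragment length of g, so its exponent is at least
-- (M + 2) / (M + 1) > 1.
--
-- Conversely, if no nice formula divides f, then repeatedly cutting all fragments at a variable
-- occurring at most once in each of them (a nice divisor of the result would divide f) empties every
-- fragment. Reversing this, for any n / d > 1 we build a word containing f whose repetitions all have
-- exponent below n / d: the cut variable becomes a block of d |w| + 1 fresh letters, w the word built
-- so far, and the fragment images are joined by further such blocks. A letter occurring only once
-- cannot lie in the periodic part of a repetition, so a repetition meeting a block has a period
-- longer than the block.

open import Defs
open import Data.Empty using (⊥-elim)
open import Data.Fin as Fin using (Fin; toℕ)
import Data.Fin.Properties as Fin
open import Data.Integer as ℤ using (-[1+_])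
import Data.Integer.Properties as ℤ
open import Data.List using (List; []; _∷_; _++_; length; map; concat; concatMap; applyUpTo)
open import Data.List.Extrema.Nat using (max; xs≤max; argmax; argmax-sel; f[⊥]≤f[argmax]; f[xs]≤f[argmax])
open import Data.List.Membership.Propositional using (_∈_; find; lose)
open import Data.List.Membership.Propositional.Properties
  using (∈-++⁻; ∈-++⁺ˡ; ∈-++⁺ʳ; ∈-map⁺; ∈-map⁻; ∈-concat⁺′; ∈-concat⁻′; ∈-concatMap⁺; ∈-concatMap⁻)
open import Data.List.NonEmpty as List⁺ using (List⁺; toList)
import Data.List.NonEmpty.Properties as List⁺
open import Data.List.Properties
  using (length-++; length-++-≤ˡ; length-map; length-applyUpTo; ++-assoc; ++-identityʳ; map-++; concat-++)
open import Data.List.Relation.Unary.All as All using (All; []; _∷_; all?)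
import Data.List.Relation.Unary.All.Properties as All
open import Data.List.Relation.Unary.Any using (here; there; any?)
open import Data.Maybe as Maybe using (just)
import Data.Maybe.Properties as Maybe
open import Data.Nat as ℕ using (ℕ; zero; suc; _+_; _*_; _∸_; _≤_; _<_; _⊔_; z≤n; s≤s; _≟_; _≤?_; _<?_)
open import Data.Nat.DivMod using (_mod_; m<n⇒m%n≡m)
open import Data.Nat.Induction using (<-rec)
open import Data.Nat.ListAction using (sum)
open import Data.Nat.ListAction.Properties using (sum-++)
import Data.Nat.Properties as ℕ
open import Data.Nat.Tactic.RingSolver using (solve-∀)
open import Data.Product as Product using (Σ; ∃; ∃₂; _×_; _,_; proj₁; proj₂)
open import Data.Rational as ℚ using (mkℚ; _/_; 1ℚ; toℚᵘ)
import Data.Rational.Properties as ℚ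
open import Data.Rational.Unnormalised as ℚᵘ using (mkℚᵘ)
import Data.Rational.Unnormalised.Properties as ℚᵘ
open import Data.Sum as Sum using (_⊎_; inj₁; inj₂)
open import Function using (_∘_)
open import Function.Bundles using (_⇔_; mk⇔)
open import Relation.Binary.Definitions using (DecidableEquality)
open import Relation.Binary.PropositionalEquality
open import Relation.Nullary using (¬_; Dec; yes; no)
import Relation.Nullary.Decidable as Dec
open import Relation.Nullary.Decidable using (_×-dec_; _→-dec_)

Factor-refl : ∀ {A : Set} (u : List A) → Factor u u
Factor-refl u = [] , [] , ++-identityʳ u

Factor-trans : ∀ {A : Set} {u v w : List A} → Factor u v → Factor v w → Factor u w
Factor-trans {u = u} (x₁ , y₁ , refl) (x₂ , y₂ , refl) = x₂ ++ x₁ , y₁ ++ y₂ , eq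
  where
  open ≡-Reasoning
  eq : (x₂ ++ x₁) ++ u ++ y₁ ++ y₂ ≡ x₂ ++ (x₁ ++ u ++ y₁) ++ y₂
  eq = begin
    (x₂ ++ x₁) ++ u ++ y₁ ++ y₂   ≡⟨ ++-assoc x₂ x₁ _ ⟩
    x₂ ++ x₁ ++ u ++ y₁ ++ y₂     ≡⟨ cong (λ z → x₂ ++ x₁ ++ z) (++-assoc u y₁ y₂) ⟨
    x₂ ++ x₁ ++ (u ++ y₁) ++ y₂   ≡⟨ cong (x₂ ++_) (++-assoc x₁ (u ++ y₁) y₂) ⟨
    x₂ ++ (x₁ ++ u ++ y₁) ++ y₂   ∎

Factor-∷ : ∀ {A : Set} (a : A) {u w : List A} → Factor u w → Factor u (a ∷ w)
Factor-∷ a (x , y , refl) = a ∷ x , y , refl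

Factor-++ʳ : ∀ {A : Set} (a : List A) {u w : List A} → Factor u w → Factor u (a ++ w)
Factor-++ʳ a {u} (x , y , refl) = a ++ x , y , ++-assoc a x (u ++ y)

Factor-length : ∀ {A : Set} {u w : List A} → Factor u w → length u ≤ length w
Factor-length {u = u} (x , y , refl) = begin
  length u                  ≤⟨ ℕ.m≤n+m (length u) (length x) ⟩
  length x + length u       ≤⟨ ℕ.+-monoʳ-≤ (length x) (ℕ.m≤m+n (length u) (length y)) ⟩
  length x + (length u + length y) ≡⟨ cong (length x +_) (length-++ u) ⟨
  length x + length (u ++ y) ≡⟨ length-++ x ⟨
  length (x ++ u ++ y)      ∎
  where open ℕ.≤-Reasoning

Factor-All : ∀ {A : Set} {P : A → Set} {u w : List A} → Factor u w → All P w → All P u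
Factor-All {u = u} (x , y , refl) a = All.++⁻ˡ u (All.++⁻ʳ x a)

Factor-map : ∀ {A B : Set} (f : A → B) {u w : List A} → Factor u w → Factor (map f u) (map f w)
Factor-map f {u} (x , y , refl) =
  map f x , map f y , sym (trans (map-++ f x (u ++ y)) (cong (map f x ++_) (map-++ f u y)))

Factor-∈ : ∀ {A : Set} {a : A} {v u} → Factor v u → a ∈ v → a ∈ u
Factor-∈ (x , y , refl) a∈ = ∈-++⁺ʳ x (∈-++⁺ˡ a∈)

applyM-++ : ∀ {B : Set} (h : Morphism B) u v → applyM h (u ++ v) ≡ applyM h u ++ applyM h v
applyM-++ h u v = trans (cong concat (map-++ _ u v)) (sym (concat-++ (map _ u) (map _ v)))

Factor-applyM : ∀ {B : Set} (h : Morphism B) {u w : List Var} →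
  Factor u w → Factor (applyM h u) (applyM h w)
Factor-applyM h {u} (x , y , refl) =
  applyM h x , applyM h y , sym (trans (applyM-++ h x (u ++ y)) (cong (applyM h x ++_) (applyM-++ h u y)))

applyM-cong : ∀ {B : Set} {h h′ : Morphism B} u → (∀ {Y} → Y ∈ u → h Y ≡ h′ Y) → applyM h u ≡ applyM h′ u
applyM-cong [] e = refl
applyM-cong (Y ∷ u) e = cong₂ (λ a b → toList a ++ b) (e (here refl)) (applyM-cong u (e ∘ there))

applyM-map : ∀ {A B : Set} (f : A → B) (h : Morphism A) u →
  applyM (List⁺.map f ∘ h) u ≡ map f (applyM h u)
applyM-map f h [] = refl
applyM-map f h (X ∷ u) with h X
... | a List⁺.∷ as = cong (f a ∷_) (trans (cong (map f as ++_) (applyM-map f h u)) (sym (map-++ f as (applyM h u))))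

_∘ₘ_ : ∀ {A : Set} → Morphism A → Morphism Var → Morphism A
(h ∘ₘ m) X = List⁺.concatMap h (m X)

applyM-∘ₘ : ∀ {A : Set} (h : Morphism A) m u → applyM (h ∘ₘ m) u ≡ applyM h (applyM m u)
applyM-∘ₘ h m [] = refl
applyM-∘ₘ h m (X ∷ u) = trans (cong₂ _++_ (sym (List⁺.toList->>= h (m X))) (applyM-∘ₘ h m u))
  (sym (applyM-++ h (toList (m X)) (applyM m u)))

at-++ˡ : ∀ {A : Set} (xs ys : List A) {i} → i < length xs → at (xs ++ ys) i ≡ at xs i
at-++ˡ (x ∷ xs) ys {zero} _ = refl
at-++ˡ (x ∷ xs) ys {suc i} (s≤s i<) = at-++ˡ xs ys i<

at-++ʳ : ∀ {A : Set} (xs ys : List A) i → at (xs ++ ys) (length xs + i) ≡ at ys i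
at-++ʳ [] ys i = refl
at-++ʳ (x ∷ xs) ys i = at-++ʳ xs ys i

at-infix : ∀ {A : Set} (x v y : List A) {i} → i < length v → at (x ++ v ++ y) (length x + i) ≡ at v i
at-infix x v y i< = trans (at-++ʳ x (v ++ y) _) (at-++ˡ v y i<)

at-map : ∀ {A B : Set} (f : A → B) w i → at (map f w) i ≡ Maybe.map f (at w i)
at-map f [] i = refl
at-map f (x ∷ w) zero = refl
at-map f (x ∷ w) (suc i) = at-map f w i

at-applyUpTo : ∀ {A : Set} (f : ℕ → A) {n i} → i < n → at (applyUpTo f n) i ≡ just (f i)
at-applyUpTo f {suc n} {zero} _ = refl
at-applyUpTo f {suc n} {suc i} (s≤s i<n) = at-applyUpTo (f ∘ suc) i<n

at-All : ∀ {A : Set} {P : A → Set} {w : List A} {i} → All P w → i < length w →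
  ∃ λ c → at w i ≡ just c × P c
at-All {w = c ∷ w} {zero} (pc ∷ _) _ = c , refl , pc
at-All {w = c ∷ w} {suc i} (_ ∷ pw) (s≤s i<) = at-All pw i<

-- Repetitions

-- The factor of w of length q + r starting at position s has period q.
record Repeats {A : Set} (w : List A) (s q r : ℕ) : Set where
  constructor repeats
  field
    bound  : s + q + r ≤ length w
    period : ∀ j → j < r → at w (s + j) ≡ at w (s + j + q)

-- Every repetition of w has exponent (q + r) / q below n / d.
BoundedRepetitions : ∀ {A : Set} → ℕ → ℕ → List A → Set
BoundedRepetitions n d w = ∀ {s q r} → 1 ≤ q → 1 ≤ r → Repeats w s q r → d * (q + r) < n * q

+-<-shift : ∀ s q {j r} → j < r → s + j + q < s + q + r
+-<-shift s q {j} {r} j<r = subst (_< s + q + r) (swap s q j) (ℕ.+-monoʳ-< (s + q) j<r)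
  where
  swap : ∀ s q j → s + q + j ≡ s + j + q
  swap = solve-∀

period-end< : ∀ s q {r j L} → s + q + r ≤ L → j < r → s + j + q < L
period-end< s q bound j<r = ℕ.<-≤-trans (+-<-shift s q j<r) bound

period-start< : ∀ s q {r j L} → s + q + r ≤ L → j < r → s + j < L
period-start< s q {j = j} bound j<r = ℕ.≤-<-trans (ℕ.m≤m+n (s + j) q) (period-end< s q bound j<r)

at-infix≡ : ∀ {A : Set} (x v y : List A) {i k} → k ≡ length x + i → i < length v →
  at (x ++ v ++ y) k ≡ at v i
at-infix≡ x v y refl = at-infix x v y

shift-end : ∀ a s j q → a + s + j + q ≡ a + (s + j + q)
shift-end = solve-∀

shift-length : ∀ a s q r → a + s + q + r ≡ a + (s + q + r)
shift-length = solve-∀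

Repeats-infix⁺ : ∀ {A : Set} (x v y : List A) {s q r} →
  Repeats v s q r → Repeats (x ++ v ++ y) (length x + s) q r
Repeats-infix⁺ x v y {s} {q} {r} (repeats bound period) = repeats bound′ period′
  where
  bound′ : length x + s + q + r ≤ length (x ++ v ++ y)
  bound′ = begin
    length x + s + q + r              ≡⟨ shift-length (length x) s q r ⟩
    length x + (s + q + r)            ≤⟨ ℕ.+-monoʳ-≤ (length x) (ℕ.≤-trans bound (ℕ.m≤m+n (length v) (length y))) ⟩
    length x + (length v + length y)  ≡⟨ trans (length-++ x) (cong (length x +_) (length-++ v)) ⟨
    length (x ++ v ++ y)              ∎
    where open ℕ.≤-Reasoning
  period′ : ∀ j → j < r → at (x ++ v ++ y) (length x + s + j) ≡ at (x ++ v ++ y) (length x + s + j + q)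
  period′ j j<r = trans (at-infix≡ x v y (ℕ.+-assoc (length x) s j) (period-start< s q bound j<r))
    (trans (period j j<r) (sym (at-infix≡ x v y (shift-end (length x) s j q) (period-end< s q bound j<r))))

Repeats-infix⁻ : ∀ {A : Set} (x v y : List A) {s q r} →
  Repeats (x ++ v ++ y) (length x + s) q r → s + q + r ≤ length v → Repeats v s q r
Repeats-infix⁻ x v y {s} {q} {r} (repeats _ period) bound = repeats bound period′
  where
  period′ : ∀ j → j < r → at v (s + j) ≡ at v (s + j + q)
  period′ j j<r = trans (sym (at-infix≡ x v y (ℕ.+-assoc (length x) s j) (period-start< s q bound j<r)))
    (trans (period j j<r) (at-infix≡ x v y (shift-end (length x) s j q) (period-end< s q bound j<r)))

Repeats-map : ∀ {A B : Set} (f : A → B) {w : List A} {s q r} → Repeats w s q r → Repeats (map f w) s q r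
Repeats-map f {w} (repeats bound period) =
  repeats (subst (_ ≤_) (sym (length-map f w)) bound)
          (λ j j<r → trans (at-map f w _) (trans (cong (Maybe.map f) (period j j<r)) (sym (at-map f w _))))

IsPeriod⇒Repeats : ∀ {A : Set} {u : List A} {q} → IsPeriod u q → q ≤ length u → Repeats u 0 q (length u ∸ q)
IsPeriod⇒Repeats {u = u} {q} (_ , period) q≤ = repeats (ℕ.≤-reflexive (ℕ.m+[n∸m]≡n q≤)) period′
  where
  period′ : ∀ j → j < length u ∸ q → at u j ≡ at u (j + q)
  period′ j j< = period j (subst (j + q <_) (ℕ.m+[n∸m]≡n q≤)
    (subst (_< q + (length u ∸ q)) (ℕ.+-comm q j) (ℕ.+-monoʳ-< q j<)))

BoundedRepetitions-[] : ∀ {A : Set} n d → BoundedRepetitions {A} n d []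
BoundedRepetitions-[] n d {s} {q} {r} _ r≥1 (repeats bound _) =
  ⊥-elim (ℕ.n≮0 (ℕ.≤-trans r≥1 (ℕ.≤-trans (ℕ.m≤n+m r (s + q)) bound)))

BoundedRepetitions-Factor : ∀ {A : Set} {n d} {v w : List A} →
  Factor v w → BoundedRepetitions n d w → BoundedRepetitions n d v
BoundedRepetitions-Factor {v = v} (x , y , refl) bounded q≥1 r≥1 rep =
  bounded q≥1 r≥1 (Repeats-infix⁺ x v y rep)

BoundedRepetitions-map⁻ : ∀ {A B : Set} (f : A → B) {n d} {w : List A} →
  BoundedRepetitions n d (map f w) → BoundedRepetitions n d w
BoundedRepetitions-map⁻ f bounded q≥1 r≥1 rep = bounded q≥1 r≥1 (Repeats-map f rep)

long-period-exponent< : ∀ {n d q r L P} → d < n → r ≤ L → d * L < P → P ≤ q → d * (q + r) < n * q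
long-period-exponent< {n} {d} {q} {r} d<n r≤L dL<P P≤q = begin-strict
  d * (q + r)    ≡⟨ ℕ.*-distribˡ-+ d q r ⟩
  d * q + d * r  <⟨ ℕ.+-monoʳ-< (d * q) (ℕ.≤-<-trans (ℕ.*-monoʳ-≤ d r≤L) (ℕ.<-≤-trans dL<P P≤q)) ⟩
  d * q + q      ≡⟨ ℕ.+-comm (d * q) q ⟩
  suc d * q      ≤⟨ ℕ.*-monoˡ-≤ q d<n ⟩
  n * q          ∎
  where open ℕ.≤-Reasoning

separator : ℕ → ℕ → List ℕ
separator b P = applyUpTo (b +_) P

length-separator : ∀ b P → length (separator b P) ≡ P
length-separator b P = length-applyUpTo (b +_) P

separator-< : ∀ b P → All (_< b + P) (separator b P)
separator-< b P = All.applyUpTo⁺₁ (b +_) P (ℕ.+-monoʳ-< b)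

module Separated {w₁ w₂ : List ℕ} {b P : ℕ} (w₁<b : All (_< b) w₁) (w₂<b : All (_< b) w₂) where

  private
    W = w₁ ++ separator b P ++ w₂
    L = length w₁

  length-W : length W ≡ L + (P + length w₂)
  length-W = trans (length-++ w₁) (cong (L +_)
    (trans (length-++ (separator b P)) (cong (_+ length w₂) (length-separator b P))))

  at-separator : ∀ {k} → k < P → at W (L + k) ≡ just (b + k)
  at-separator k<P = trans (at-infix w₁ (separator b P) w₂ (subst (_ <_) (sym (length-separator b P)) k<P))
                           (at-applyUpTo (b +_) k<P)

  at-w₂ : ∀ t → at W (L + (P + t)) ≡ at w₂ t
  at-w₂ t = trans (at-++ʳ w₁ _ (P + t))
    (subst (λ m → at (separator b P ++ w₂) (m + t) ≡ at w₂ t) (length-separator b P) (at-++ʳ (separator b P) w₂ t))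

  separator-offset< : ∀ {x} → L ≤ x → x < L + P → x ∸ L < P
  separator-offset< L≤x x< = ℕ.+-cancelˡ-< L _ _ (subst (_< L + P) (sym (ℕ.m+[n∸m]≡n L≤x)) x<)

  data Position (i : ℕ) : Set where
    inSeparator : ∀ k → k < P → i ≡ L + k → Position i
    outside : ∀ c → c < b → at W i ≡ just c → Position i

  position : ∀ i → i < length W → Position i
  position i i<W with i <? L
  ... | yes i<L with at-All w₁<b i<L
  ...   | c , eq , c<b = outside c c<b (trans (at-++ˡ w₁ _ i<L) eq)
  position i i<W | no i≮L with i ∸ L <? P
  ... | yes k<P = inSeparator (i ∸ L) k<P (sym (ℕ.m+[n∸m]≡n (ℕ.≮⇒≥ i≮L)))
  ... | no k≮P = outside-w₂ (trans (sym (ℕ.m+[n∸m]≡n (ℕ.≮⇒≥ i≮L))) (cong (L +_) (sym (ℕ.m+[n∸m]≡n (ℕ.≮⇒≥ k≮P)))))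
    where
    outside-w₂ : ∀ {t} → i ≡ L + (P + t) → Position i
    outside-w₂ {t} i≡ with at-All w₂<b (ℕ.+-cancelˡ-< P _ _ (ℕ.+-cancelˡ-< L _ _ (subst₂ _<_ i≡ length-W i<W)))
    ... | c , eq , c<b = outside c c<b (trans (cong (at W) i≡) (trans (at-w₂ t) eq))

  separator-once : ∀ {k x} → k < P → x < length W → at W x ≡ at W (L + k) → x ≡ L + k
  separator-once {k} {x} k<P x<W eq with position x x<W
  ... | inSeparator k′ k′<P refl =
    cong (L +_) (ℕ.+-cancelˡ-≡ b k′ k (Maybe.just-injective
      (trans (sym (at-separator k′<P)) (trans eq (at-separator k<P)))))
  ... | outside c c<b eqc = ⊥-elim (ℕ.<⇒≱ c<b (ℕ.≤-trans (ℕ.m≤m+n b k) (ℕ.≤-reflexive c≡)))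
    where
    c≡ : b + k ≡ c
    c≡ = Maybe.just-injective (trans (sym (at-separator k<P)) (trans (sym eq) eqc))

  module _ {s q r} (q≥1 : 1 ≤ q) (rep : Repeats W s q r) where
    open Repeats rep

    separator-∉-period-start : ∀ {j k} → j < r → k < P → s + j ≢ L + k
    separator-∉-period-start j<r k<P e = ℕ.<⇒≢ (ℕ.m<m+n _ q≥1)
      (trans e (sym (separator-once k<P (period-end< s q bound j<r) (trans (sym (period _ j<r)) (cong (at W) e)))))

    separator-∉-period-end : ∀ {j k} → j < r → k < P → s + j + q ≢ L + k
    separator-∉-period-end j<r k<P e = ℕ.<⇒≢ (ℕ.m<m+n _ q≥1)
      (trans (separator-once k<P (period-start< s q bound j<r) (trans (period _ j<r) (cong (at W) e))) (sym e))

    -- The letters of the separator are unique in W, so none lies in the first or last r positions of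
    -- the repetition; a repetition meeting the separator without lying in w₁ or w₂ therefore contains
    -- the whole separator in its middle part [s + r, s + q).
    crossing-bounds : 1 ≤ r → 0 < P → s < L + P → L < s + q + r → r ≤ L × P ≤ q
    crossing-bounds r≥1 P≥1 s<L+P L<end =
      ℕ.≤-trans (ℕ.m≤n+m r s) s+r≤L ,
      ℕ.+-cancelˡ-≤ L P q (ℕ.≤-trans L+P≤s+q (ℕ.+-monoˡ-≤ q s≤L))
      where
      s≤L : s ≤ L
      s≤L with s <? L
      ... | yes s<L = ℕ.<⇒≤ s<L
      ... | no s≮L = ⊥-elim (separator-∉-period-start r≥1 (separator-offset< L≤s s<L+P)
                               (trans (ℕ.+-identityʳ s) (sym (ℕ.m+[n∸m]≡n L≤s))))
        where L≤s = ℕ.≮⇒≥ s≮L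

      s+r≤L : s + r ≤ L
      s+r≤L with s + r ≤? L
      ... | yes s+r≤L = s+r≤L
      ... | no s+r≰L = ⊥-elim (separator-∉-period-start j<r P≥1 (trans (ℕ.m+[n∸m]≡n s≤L) (sym (ℕ.+-identityʳ L))))
        where
        j<r : L ∸ s < r
        j<r = ℕ.+-cancelˡ-< s _ r (subst (_< s + r) (sym (ℕ.m+[n∸m]≡n s≤L)) (ℕ.≰⇒> s+r≰L))

      L+P≤s+q : L + P ≤ s + q
      L+P≤s+q with L + P ≤? s + q
      ... | yes L+P≤s+q = L+P≤s+q
      ... | no L+P≰s+q with s + q <? L
      ...   | yes s+q<L = ⊥-elim (separator-∉-period-end j<r P≥1 e)
        where
        s+q≤L = ℕ.<⇒≤ s+q<L
        j<r : L ∸ (s + q) < r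
        j<r = ℕ.+-cancelˡ-< (s + q) _ r (subst (_< s + q + r) (sym (ℕ.m+[n∸m]≡n s+q≤L)) L<end)
        e : s + (L ∸ (s + q)) + q ≡ L + 0
        e = trans (trans (swap s _ q) (ℕ.m+[n∸m]≡n s+q≤L)) (sym (ℕ.+-identityʳ L))
          where
          swap : ∀ s j q → s + j + q ≡ s + q + j
          swap = solve-∀
      ...   | no s+q≮L = ⊥-elim (separator-∉-period-end r≥1 (separator-offset< L≤s+q (ℕ.≰⇒> L+P≰s+q))
                                   (trans (cong (_+ q) (ℕ.+-identityʳ s)) (sym (ℕ.m+[n∸m]≡n L≤s+q))))
        where L≤s+q = ℕ.≮⇒≥ s+q≮L

  BoundedRepetitions-separated : ∀ {n d} → d < n → d * L < P →
    BoundedRepetitions n d w₁ → BoundedRepetitions n d w₂ → BoundedRepetitions n d W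
  BoundedRepetitions-separated {n} {d} d<n dL<P bounded₁ bounded₂ {s} {q} {r} q≥1 r≥1 rep
    with s + q + r ≤? L | L + P ≤? s
  ... | yes inside₁ | _ = bounded₁ q≥1 r≥1 (Repeats-infix⁻ [] w₁ (separator b P ++ w₂) rep inside₁)
  ... | no _ | yes inside₂ = bounded₂ q≥1 r≥1 (Repeats-infix⁻ (w₁ ++ separator b P) w₂ [] rep′ bound′)
    where
    s′ = s ∸ (L + P)
    s≡ : s ≡ L + P + s′
    s≡ = sym (ℕ.m+[n∸m]≡n inside₂)
    length-prefix : length (w₁ ++ separator b P) ≡ L + P
    length-prefix = trans (length-++ w₁) (cong (L +_) (length-separator b P))
    rep′ : Repeats ((w₁ ++ separator b P) ++ w₂ ++ []) (length (w₁ ++ separator b P) + s′) q r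
    rep′ = subst₂ (λ w t → Repeats w t q r)
      (sym (trans (cong (_ ++_) (++-identityʳ w₂)) (++-assoc w₁ (separator b P) w₂)))
      (trans s≡ (cong (_+ s′) (sym length-prefix))) rep
    bound′ : s′ + q + r ≤ length w₂
    bound′ = ℕ.+-cancelˡ-≤ (L + P) _ _ (subst₂ _≤_
      (trans (cong (λ t → t + q + r) s≡) (shift-length (L + P) s′ q r))
      (trans length-W (sym (ℕ.+-assoc L P _))) (Repeats.bound rep))
  ... | no crosses₁ | no crosses₂ with crossing-bounds q≥1 rep r≥1 (ℕ.≤-<-trans z≤n dL<P) (ℕ.≰⇒> crosses₂) (ℕ.≰⇒> crosses₁)
  ...   | r≤L , P≤q = long-period-exponent< d<n r≤L dL<P P≤q

-- Eliminating variables that occur at most once per fragment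

∈⇒count≥1 : ∀ {X u} → X ∈ u → 1 ≤ count X u
∈⇒count≥1 {X} {Y ∷ u} X∈ with X ≟ Y | X∈
... | yes _ | _ = s≤s z≤n
... | no X≢Y | here X≡Y = ⊥-elim (X≢Y X≡Y)
... | no _ | there X∈u = ∈⇒count≥1 X∈u

count≡0⇒∉ : ∀ {X Y u} → count X u ≡ 0 → Y ∈ u → Y ≢ X
count≡0⇒∉ {X} {Y} c Y∈ refl = ℕ.<⇒≢ (∈⇒count≥1 Y∈) (sym c)

split-first : ∀ X u → 1 ≤ count X u →
  ∃₂ λ s t → u ≡ s ++ X ∷ t × count X s ≡ 0 × count X u ≡ suc (count X t)
split-first X (Y ∷ u) c with X ≟ Y
... | yes refl = [] , u , refl , refl , refl
... | no X≢Y with split-first X u c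
...   | s , t , refl , cs , cu = Y ∷ s , t , refl , cs′ , cu
  where
  cs′ : count X (Y ∷ s) ≡ 0
  cs′ with X ≟ Y
  ... | yes X≡Y = ⊥-elim (X≢Y X≡Y)
  ... | no _ = cs

_◃_ : Var → List⁺ (List Var) → List⁺ (List Var)
Y ◃ ps = (Y ∷ List⁺.head ps) List⁺.∷ List⁺.tail ps

◃-toList : ∀ Y {ps p qs} → toList ps ≡ p ∷ qs → toList (Y ◃ ps) ≡ (Y ∷ p) ∷ qs
◃-toList Y refl = refl

-- The maximal X-free factors of u, in order (u = p₀ X p₁ X … X pₖ).
cut : Var → List Var → List⁺ (List Var)
cut X [] = List⁺.[ [] ]
cut X (Y ∷ u) with X ≟ Y
... | yes _ = [] List⁺.∷⁺ cut X u
... | no _ = Y ◃ cut X u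

cutAll : Var → List (List Var) → List (List Var)
cutAll X = concatMap (toList ∘ cut X)

cut-absent : ∀ X u → count X u ≡ 0 → toList (cut X u) ≡ u ∷ []
cut-absent X [] c = refl
cut-absent X (Y ∷ u) c with X ≟ Y
... | no _ = ◃-toList Y (cut-absent X u c)

cut-single : ∀ X u v → count X u ≡ 0 → count X v ≡ 0 → toList (cut X (u ++ X ∷ v)) ≡ u ∷ v ∷ []
cut-single X [] v cu cv with X ≟ X
... | yes _ rewrite cut-absent X v cv = refl
... | no X≢X = ⊥-elim (X≢X refl)
cut-single X (Y ∷ u) v cu cv with X ≟ Y
... | no _ = ◃-toList Y (cut-single X u v cu cv)

cut-head-prefix : ∀ X u → ∃ λ y → List⁺.head (cut X u) ++ y ≡ u
cut-head-prefix X [] = [] , refl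
cut-head-prefix X (Y ∷ u) with X ≟ Y
... | yes _ = Y ∷ u , refl
... | no _ with cut-head-prefix X u
...   | y , eq = y , cong (Y ∷_) eq

cut-Factor : ∀ X u {p} → p ∈ toList (cut X u) → Factor p u
cut-Factor X [] (here refl) = Factor-refl []
cut-Factor X (Y ∷ u) p∈ with X ≟ Y | p∈
... | yes _ | here refl = [] , Y ∷ u , refl
... | yes _ | there p∈′ = Factor-∷ Y (cut-Factor X u p∈′)
... | no _ | here refl = [] , proj₁ (cut-head-prefix X u) , cong (Y ∷_) (proj₂ (cut-head-prefix X u))
... | no _ | there p∈′ = Factor-∷ Y (cut-Factor X u (there p∈′))

size : List (List Var) → ℕ
size F = sum (map length F)

occurrences : Var → List (List Var) → ℕ
occurrences X F = sum (map (count X) F)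

size-++ : ∀ F G → size (F ++ G) ≡ size F + size G
size-++ F G = trans (cong sum (map-++ length F G)) (sum-++ (map length F) (map length G))

cut-size : ∀ X u → size (toList (cut X u)) + count X u ≡ length u
cut-size X [] = refl
cut-size X (Y ∷ u) with X ≟ Y
... | yes _ = trans (ℕ.+-suc _ _) (cong suc (cut-size X u))
... | no _ = cong suc (cut-size X u)

cutAll-size : ∀ X F → size (cutAll X F) + occurrences X F ≡ size F
cutAll-size X [] = refl
cutAll-size X (u ∷ F) = begin
  size (toList (cut X u) ++ cutAll X F) + (count X u + occurrences X F)
    ≡⟨ cong (_+ (count X u + occurrences X F)) (size-++ (toList (cut X u)) (cutAll X F)) ⟩
  size (toList (cut X u)) + size (cutAll X F) + (count X u + occurrences X F)
    ≡⟨ interchange (size (toList (cut X u))) (size (cutAll X F)) (count X u) (occurrences X F) ⟩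
  (size (toList (cut X u)) + count X u) + (size (cutAll X F) + occurrences X F)
    ≡⟨ cong₂ _+_ (cut-size X u) (cutAll-size X F) ⟩
  length u + size F ∎
  where
  open ≡-Reasoning
  interchange : ∀ a b c d → a + b + (c + d) ≡ (a + c) + (b + d)
  interchange = solve-∀

∈⇒occurrences≥1 : ∀ {X} F → X ∈ concat F → 1 ≤ occurrences X F
∈⇒occurrences≥1 (u ∷ F) X∈ with ∈-++⁻ u X∈
... | inj₁ X∈u = ℕ.≤-trans (∈⇒count≥1 X∈u) (ℕ.m≤m+n _ _)
... | inj₂ X∈F = ℕ.≤-trans (∈⇒occurrences≥1 F X∈F) (ℕ.m≤n+m _ _)

data Eliminable : List (List Var) → Set where
  all-empty : ∀ {F} → All (_≡ []) F → Eliminable F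
  cut-at : ∀ {F} X → All (λ u → count X u ≤ 1) F → Eliminable (cutAll X F) → Eliminable F

_≼*_ : Formula → List (List Var) → Set
g ≼* F = Σ (Morphism Var) λ h → ∀ φ → φ ∈ fragments g → ∃ λ u → u ∈ F × Factor (applyM h (toList φ)) u

_⊑_ : List (List Var) → List (List Var) → Set
G ⊑ F = ∀ {v} → v ∈ G → ∃ λ u → u ∈ F × Factor v u

≼*-⊑-trans : ∀ {g G F} → g ≼* G → G ⊑ F → g ≼* F
≼*-⊑-trans (h , g≼G) G⊑F = h , λ φ φ∈ →
  let (v , v∈ , φ⊆v) = g≼G φ φ∈ ; (u , u∈ , v⊆u) = G⊑F v∈ in u , u∈ , Factor-trans φ⊆v v⊆u

cutAll-⊑ : ∀ X F → cutAll X F ⊑ F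
cutAll-⊑ X F v∈ with find (∈-concatMap⁻ (toList ∘ cut X) {xs = F} v∈)
... | u , u∈ , v∈cut = u , u∈ , cut-Factor X u v∈cut

NiceDivisor : List (List Var) → Set
NiceDivisor F = Σ Formula λ g → Nice g × g ≼* F

nonEmpty : List (List Var) → List Fragment
nonEmpty [] = []
nonEmpty ([] ∷ F) = nonEmpty F
nonEmpty ((X ∷ u) ∷ F) = (X List⁺.∷ u) ∷ nonEmpty F

∈-nonEmpty⁻ : ∀ F {φ} → φ ∈ nonEmpty F → toList φ ∈ F
∈-nonEmpty⁻ ([] ∷ F) φ∈ = there (∈-nonEmpty⁻ F φ∈)
∈-nonEmpty⁻ ((X ∷ u) ∷ F) (here refl) = here refl
∈-nonEmpty⁻ ((X ∷ u) ∷ F) (there φ∈) = there (∈-nonEmpty⁻ F φ∈)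

∈-nonEmpty⁺ : ∀ F {X u} → X ∷ u ∈ F → X List⁺.∷ u ∈ nonEmpty F
∈-nonEmpty⁺ ([] ∷ F) (there u∈) = ∈-nonEmpty⁺ F u∈
∈-nonEmpty⁺ ((Y ∷ v) ∷ F) (here refl) = here refl
∈-nonEmpty⁺ ((Y ∷ v) ∷ F) (there u∈) = there (∈-nonEmpty⁺ F u∈)

nonEmpty≡[] : ∀ F → nonEmpty F ≡ [] → All (_≡ []) F
nonEmpty≡[] [] _ = []
nonEmpty≡[] ([] ∷ F) eq = refl ∷ nonEmpty≡[] F eq

applyM-identity : ∀ u → applyM List⁺.[_] u ≡ u
applyM-identity [] = refl
applyM-identity (X ∷ u) = cong (X ∷_) (applyM-identity u)

nice-or-all-empty : ∀ F → (∀ {X} → X ∈ concat F → ∃ λ u → u ∈ F × 2 ≤ count X u) →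
  NiceDivisor F ⊎ All (_≡ []) F
nice-or-all-empty F repeated with nonEmpty F in eq
... | [] = inj₂ (nonEmpty≡[] F eq)
... | φ ∷ φs = inj₁ (φ List⁺.∷ φs , nice , List⁺.[_] , divides)
  where
  from-nonEmpty : ∀ {ψ} → ψ ∈ φ ∷ φs → toList ψ ∈ F
  from-nonEmpty ψ∈ = ∈-nonEmpty⁻ F (subst (_ ∈_) (sym eq) ψ∈)
  divides : ∀ ψ → ψ ∈ φ ∷ φs → ∃ λ u → u ∈ F × Factor (applyM List⁺.[_] (toList ψ)) u
  divides ψ ψ∈ = toList ψ , from-nonEmpty ψ∈ , subst (λ v → Factor v (toList ψ)) (sym (applyM-identity (toList ψ))) (Factor-refl _)
  nice : Nice (φ List⁺.∷ φs)
  nice X (ψ , ψ∈ , X∈ψ) with repeated (∈-concat⁺′ X∈ψ (from-nonEmpty ψ∈))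
  ... | Y ∷ u , u∈ , twice = Y List⁺.∷ u , subst (_ ∈_) eq (∈-nonEmpty⁺ F u∈) , twice

nice-or-eliminable-bounded : ∀ N F → size F < N → NiceDivisor F ⊎ Eliminable F
nice-or-eliminable-bounded (suc N) F size<
  with any? (λ X → all? (λ u → count X u ≤? 1) F) (concat F)
... | no none = Sum.map₂ all-empty (nice-or-all-empty F repeated)
  where
  repeated : ∀ {X} → X ∈ concat F → ∃ λ u → u ∈ F × 2 ≤ count X u
  repeated X∈ with find (All.¬All⇒Any¬ (λ u → count _ u ≤? 1) F (none ∘ lose X∈))
  ... | u , u∈ , ¬≤1 = u , u∈ , ℕ.≰⇒> ¬≤1
... | yes some with find some
...   | X , X∈ , atMostOnce with nice-or-eliminable-bounded N (cutAll X F) smaller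
  where
  smaller : size (cutAll X F) < N
  smaller = ℕ.<-≤-trans (ℕ.<-≤-trans (ℕ.m<m+n _ (∈⇒occurrences≥1 F X∈)) (ℕ.≤-reflexive (cutAll-size X F))) (ℕ.≤-pred size<)
...     | inj₁ (g , nice , g≼) = inj₁ (g , nice , ≼*-⊑-trans g≼ (cutAll-⊑ X F))
...     | inj₂ eliminable = inj₂ (cut-at X atMostOnce eliminable)

nice-or-eliminable : ∀ F → NiceDivisor F ⊎ Eliminable F
nice-or-eliminable F = nice-or-eliminable-bounded (suc (size F)) F ℕ.≤-refl

-- Words with bounded repetitions containing an eliminable list

letterBound : List ℕ → ℕ
letterBound w = suc (max 0 w)

<letterBound : ∀ w → All (_< letterBound w) w
<letterBound w = All.map s≤s (xs≤max 0 w)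

All-<-weaken : ∀ {a b} {w : List ℕ} → a ≤ b → All (_< a) w → All (_< b) w
All-<-weaken a≤b = All.map (λ c<a → ℕ.≤-trans c<a a≤b)

_[_↦_] : ∀ {A : Set} → Morphism A → Var → List⁺ A → Morphism A
(h [ X ↦ a ]) Y with Y ≟ X
... | yes _ = a
... | no _ = h Y

update-≡ : ∀ {A : Set} (h : Morphism A) X a → (h [ X ↦ a ]) X ≡ a
update-≡ h X a with X ≟ X
... | yes _ = refl
... | no X≢X = ⊥-elim (X≢X refl)

applyM-update-absent : ∀ {A : Set} (h : Morphism A) X a u → count X u ≡ 0 → applyM (h [ X ↦ a ]) u ≡ applyM h u
applyM-update-absent h X a u c = applyM-cong u update-≢
  where
  update-≢ : ∀ {Y} → Y ∈ u → (h [ X ↦ a ]) Y ≡ h Y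
  update-≢ {Y} Y∈ with Y ≟ X
  ... | yes Y≡X = ⊥-elim (count≡0⇒∉ c Y∈ Y≡X)
  ... | no _ = refl

module Construction {n d : ℕ} (d<n : d < n) where

  Admissible : ℕ → List ℕ → Set
  Admissible b w = BoundedRepetitions n d w × All (_< b) w

  joinAbove : ℕ → List (List ℕ) → List ℕ
  joinAbove b [] = []
  joinAbove b (w ∷ ws) = w ++ separator (b ⊔ letterBound rest) (suc (d * length w)) ++ rest
    where rest = joinAbove b ws

  joinAbove-bounded : ∀ b ws → All (Admissible b) ws → BoundedRepetitions n d (joinAbove b ws)
  joinAbove-bounded b [] [] = BoundedRepetitions-[] n d
  joinAbove-bounded b (w ∷ ws) ((bounded , w<b) ∷ admissible) =
    Separated.BoundedRepetitions-separated
      (All-<-weaken (ℕ.m≤m⊔n b _) w<b) (All-<-weaken (ℕ.m≤n⊔m b _) (<letterBound (joinAbove b ws)))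
      d<n ℕ.≤-refl bounded (joinAbove-bounded b ws admissible)

  joinAbove-Factor : ∀ b {ws w} → w ∈ ws → Factor w (joinAbove b ws)
  joinAbove-Factor b (here refl) = [] , _ , refl
  joinAbove-Factor b {v ∷ ws} (there w∈) = Factor-++ʳ v (Factor-++ʳ (separator _ _) (joinAbove-Factor b w∈))

  SparseOccurrence : List (List Var) → Set
  SparseOccurrence F = Σ (List ℕ) λ w → Σ (Morphism ℕ) λ h →
    BoundedRepetitions n d w × (∀ {u} → u ∈ F → Factor (applyM h u) w)

  eliminable⇒sparse-occurrence : ∀ {F} → Eliminable F → SparseOccurrence F
  eliminable⇒sparse-occurrence {F} (all-empty empty) =
    [] , (λ _ → List⁺.[ 0 ]) , BoundedRepetitions-[] n d ,
    λ u∈ → subst (λ u → Factor (applyM _ u) []) (sym (All.lookup empty u∈)) (Factor-refl [])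
  eliminable⇒sparse-occurrence {F} (cut-at X atMostOnce eliminable)
    with eliminable⇒sparse-occurrence eliminable
  ... | w′ , h′ , bounded′ , occurs′ = w , h , joinAbove-bounded b images admissible , occurs
    where
    B = letterBound w′
    m = d * length w′
    b = B + suc m
    -- X becomes a block of fresh letters long enough to separate the images of its two sides.
    h = h′ [ X ↦ B + 0 List⁺.∷ applyUpTo (λ i → B + suc i) m ]
    images = map (applyM h) F
    w = joinAbove b images

    from-w′ : ∀ {v} → Factor v w′ → Admissible B v
    from-w′ v⊆w′ = BoundedRepetitions-Factor {n = n} {d} v⊆w′ bounded′ , Factor-All v⊆w′ (<letterBound w′)

    piece-of-w′ : ∀ {u v} → u ∈ F → v ∈ toList (cut X u) → Factor (applyM h′ v) w′
    piece-of-w′ {u} u∈ v∈ = occurs′ (∈-concatMap⁺ (toList ∘ cut X) (lose u∈ v∈))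

    image-admissible : ∀ {u} → u ∈ F → Admissible b (applyM h u)
    image-admissible {u} u∈ with count X u ℕ.≟ 0
    ... | yes absent =
      subst (Admissible b) (sym (applyM-update-absent h′ X _ u absent))
        (Product.map₂ (All-<-weaken (ℕ.m≤m+n B _))
          (from-w′ (piece-of-w′ u∈ (subst (u ∈_) (sym (cut-absent X u absent)) (here refl)))))
    ... | no present with split-first X u (ℕ.n≢0⇒n>0 present)
    ...   | s , t , refl , absent-s , count≡ = subst (Admissible b) (sym image≡) (bounded , letters)
      where
      absent-t : count X t ≡ 0
      absent-t = ℕ.n≤0⇒n≡0 (ℕ.≤-pred (subst (_≤ 1) count≡ (All.lookup atMostOnce u∈)))
      pieces : toList (cut X (s ++ X ∷ t)) ≡ s ∷ t ∷ []
      pieces = cut-single X s t absent-s absent-t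
      s⊆w′ : Factor (applyM h′ s) w′
      s⊆w′ = piece-of-w′ u∈ (subst (s ∈_) (sym pieces) (here refl))
      t⊆w′ : Factor (applyM h′ t) w′
      t⊆w′ = piece-of-w′ u∈ (subst (t ∈_) (sym pieces) (there (here refl)))
      image≡ : applyM h (s ++ X ∷ t) ≡ applyM h′ s ++ separator B (suc m) ++ applyM h′ t
      image≡ = trans (applyM-++ h s (X ∷ t)) (cong₂ _++_ (applyM-update-absent h′ X _ s absent-s)
        (cong₂ (λ a v → toList a ++ v) (update-≡ h′ X _) (applyM-update-absent h′ X _ t absent-t)))
      bounded : BoundedRepetitions n d (applyM h′ s ++ separator B (suc m) ++ applyM h′ t)
      bounded = Separated.BoundedRepetitions-separated
        (Factor-All s⊆w′ (<letterBound w′)) (Factor-All t⊆w′ (<letterBound w′)) d<n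
        (s≤s (ℕ.*-monoʳ-≤ d (Factor-length s⊆w′))) (proj₁ (from-w′ s⊆w′)) (proj₁ (from-w′ t⊆w′))
      letters : All (_< b) (applyM h′ s ++ separator B (suc m) ++ applyM h′ t)
      letters = All.++⁺ (All-<-weaken (ℕ.m≤m+n B _) (proj₂ (from-w′ s⊆w′)))
        (All.++⁺ (separator-< B (suc m)) (All-<-weaken (ℕ.m≤m+n B _) (proj₂ (from-w′ t⊆w′))))

    admissible : All (Admissible b) images
    admissible = All.map⁺ (All.tabulate image-admissible)

    occurs : ∀ {u} → u ∈ F → Factor (applyM h u) w
    occurs u∈ = joinAbove-Factor b (∈-map⁺ (applyM h) u∈)

toℚᵘ-/ : ∀ m a → toℚᵘ (ℤ.+ m / suc a) ℚᵘ.≃ mkℚᵘ (ℤ.+ m) a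
toℚᵘ-/ m a = ℚ.toℚᵘ-fromℚᵘ (mkℚᵘ (ℤ.+ m) a)

ℤ-*-≤⇒ : ∀ m b k a → ℤ.+ m ℤ.* ℤ.+ b ℤ.≤ ℤ.+ k ℤ.* ℤ.+ a → m * b ≤ k * a
ℤ-*-≤⇒ m b k a p rewrite sym (ℤ.pos-* m b) | sym (ℤ.pos-* k a) = ℤ.drop‿+≤+ p

ℤ-*-<⇒ : ∀ m b k a → ℤ.+ m ℤ.* ℤ.+ b ℤ.< ℤ.+ k ℤ.* ℤ.+ a → m * b < k * a
ℤ-*-<⇒ m b k a p rewrite sym (ℤ.pos-* m b) | sym (ℤ.pos-* k a) = ℤ.drop‿+<+ p

⇒ℤ-*-≤ : ∀ m b k a → m * b ≤ k * a → ℤ.+ m ℤ.* ℤ.+ b ℤ.≤ ℤ.+ k ℤ.* ℤ.+ a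
⇒ℤ-*-≤ m b k a p rewrite sym (ℤ.pos-* m b) | sym (ℤ.pos-* k a) = ℤ.+≤+ p

⇒ℤ-*-< : ∀ m b k a → m * b < k * a → ℤ.+ m ℤ.* ℤ.+ b ℤ.< ℤ.+ k ℤ.* ℤ.+ a
⇒ℤ-*-< m b k a p rewrite sym (ℤ.pos-* m b) | sym (ℤ.pos-* k a) = ℤ.+<+ p

fraction-≤ : ∀ m a k b → m * suc b ≤ k * suc a → ℤ.+ m / suc a ℚ.≤ ℤ.+ k / suc b
fraction-≤ m a k b p = ℚ.toℚᵘ-cancel-≤ (ℚᵘ.≤-respʳ-≃ (ℚᵘ.≃-sym (toℚᵘ-/ k b))
  (ℚᵘ.≤-respˡ-≃ (ℚᵘ.≃-sym (toℚᵘ-/ m a)) (ℚᵘ.*≤* (⇒ℤ-*-≤ m (suc b) k (suc a) p))))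

fraction-< : ∀ m a k b → m * suc b < k * suc a → ℤ.+ m / suc a ℚ.< ℤ.+ k / suc b
fraction-< m a k b p = ℚ.toℚᵘ-cancel-< (ℚᵘ.<-respʳ-≃ (ℚᵘ.≃-sym (toℚᵘ-/ k b))
  (ℚᵘ.<-respˡ-≃ (ℚᵘ.≃-sym (toℚᵘ-/ m a)) (ℚᵘ.*<* (⇒ℤ-*-< m (suc b) k (suc a) p))))

>1⇒fraction : ∀ {α} → 1ℚ ℚ.< α →
  ∃₂ λ n d → d < n × (∀ L q → α ℚ.≤ ℤ.+ L / suc q → n * suc q ≤ L * d)
>1⇒fraction {mkℚ (ℤ.+ n) e _} (ℚ.*<* 1<α) = n , suc e , d<n , α≤⇒
  where
  d<n : suc e < n
  d<n = subst₂ _<_ (ℕ.*-identityˡ (suc e)) (ℕ.*-identityʳ n) (ℤ-*-<⇒ 1 (suc e) n 1 1<α)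
  α≤⇒ : ∀ L q → mkℚ (ℤ.+ n) e _ ℚ.≤ ℤ.+ L / suc q → n * suc q ≤ L * suc e
  α≤⇒ L q α≤ with ℚᵘ.≤-respʳ-≃ (toℚᵘ-/ L q) (ℚ.toℚᵘ-mono-≤ α≤)
  ... | ℚᵘ.*≤* p = ℤ-*-≤⇒ n (suc q) L (suc e) p
>1⇒fraction {mkℚ -[1+ _ ] _ _} (ℚ.*<* ())

bounded⇒free : ∀ {A : Set} {n d α} {w : List A} → d < n →
  (∀ L q → α ℚ.≤ ℤ.+ L / suc q → n * suc q ≤ L * d) → BoundedRepetitions n d w → Free α w
bounded⇒free {n = n} {d} d<n α≤⇒ bounded u (x , y , refl) (_ , p , (period , _) , α≤)
  with suc p <? length u
... | no q≮u = ℕ.<⇒≱ d<n (ℕ.*-cancelʳ-≤ n d (suc p) (begin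
  n * suc p       ≤⟨ α≤⇒ (length u) p α≤ ⟩
  length u * d    ≤⟨ ℕ.*-monoˡ-≤ d (ℕ.≮⇒≥ q≮u) ⟩
  suc p * d       ≡⟨ ℕ.*-comm (suc p) d ⟩
  d * suc p       ∎))
  where open ℕ.≤-Reasoning
... | yes q<u = ℕ.<⇒≱
  (bounded (s≤s z≤n) (ℕ.m<n⇒0<n∸m q<u) (Repeats-infix⁺ x u y (IsPeriod⇒Repeats period (ℕ.<⇒≤ q<u))))
  (begin
    n * suc p                  ≤⟨ α≤⇒ (length u) p α≤ ⟩
    length u * d               ≡⟨ ℕ.*-comm (length u) d ⟩
    d * length u               ≡⟨ cong (d *_) (ℕ.m+[n∸m]≡n (ℕ.<⇒≤ q<u)) ⟨
    d * (suc p + (length u ∸ suc p)) ∎)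
  where open ℕ.≤-Reasoning

-- Repetitions forced by a nice formula

Least : (ℕ → Set) → Set
Least P = ∃ λ p → P p × (∀ q → q < p → ¬ P q)

least : ∀ {P : ℕ → Set} → (∀ n → Dec (P n)) → ∀ {N} → P N → Least P
least {P} P? {N} = <-rec (λ N → P N → Least P) step N
  where
  step : ∀ N → (∀ {M} → M < N → P M → Least P) → P N → Least P
  step N smaller PN with ℕ.anyUpTo? P? N
  ... | yes (M , M<N , PM) = smaller M<N PM
  ... | no none = N , PN , λ q q<N Pq → none (q , q<N , Pq)

IsPeriod? : ∀ {A : Set} → DecidableEquality A → ∀ (u : List A) p → Dec (IsPeriod u p)
IsPeriod? _≟ₐ_ u p = (1 ≤? p) ×-dec Dec.map′ everywhere (λ matches _ → matches _) (ℕ.allUpTo? matches? (length u))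
  where
  Matches : ℕ → Set
  Matches i = i + p < length u → at u i ≡ at u (i + p)
  matches? : ∀ i → Dec (Matches i)
  matches? i = (i + p <? length u) →-dec Maybe.≡-dec _≟ₐ_ (at u i) (at u (i + p))
  everywhere : (∀ {i} → i < length u → Matches i) → ∀ i → Matches i
  everywhere matches i i+p<u = matches (ℕ.≤-<-trans (ℕ.m≤m+n i p) i+p<u) i+p<u

length-xyx : ∀ {A : Set} (x y : List A) → length (x ++ y ++ x) ≡ length x + length y + length x
length-xyx x y = trans (length-++ x) (trans (cong (length x +_) (length-++ y)) (sym (ℕ.+-assoc (length x) _ _)))

xyx-period : ∀ {A : Set} (x y : List A) → 1 ≤ length x → IsPeriod (x ++ y ++ x) (length x + length y)
xyx-period x y x≥1 = ℕ.≤-trans x≥1 (ℕ.m≤m+n _ _) , period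
  where
  p = length x + length y
  period : ∀ i → i + p < length (x ++ y ++ x) → at (x ++ y ++ x) i ≡ at (x ++ y ++ x) (i + p)
  period i i+p< = trans (at-++ˡ x (y ++ x) i<x) (sym (begin
    at (x ++ y ++ x) (i + p)         ≡⟨ cong (λ z → at z (i + p)) (++-assoc x y x) ⟨
    at ((x ++ y) ++ x) (i + p)       ≡⟨ cong (at ((x ++ y) ++ x)) (trans (cong (_+ i) (length-++ x)) (ℕ.+-comm p i)) ⟨
    at ((x ++ y) ++ x) (length (x ++ y) + i) ≡⟨ at-++ʳ (x ++ y) x i ⟩
    at x i                           ∎))
    where
    open ≡-Reasoning
    i<x : i < length x
    i<x = ℕ.+-cancelˡ-< p i (length x) (subst₂ _<_ (ℕ.+-comm i p) (length-xyx x y) i+p<)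

xyx-exponent-arith : ∀ M a b p → p ≤ a + b → b ≤ M * a → (M + 2) * p ≤ (a + b + a) * suc M
xyx-exponent-arith M a b p p≤ b≤ = ℕ.≤-trans (ℕ.*-monoʳ-≤ (M + 2) p≤)
  (ℕ.+-cancelʳ-≤ (M * a) _ _ (ℕ.≤-trans (ℕ.≤-reflexive (identity M a b)) (ℕ.+-monoʳ-≤ _ b≤)))
  where
  identity : ∀ M a b → (M + 2) * (a + b) + M * a ≡ (a + b + a) * suc M + b
  identity = solve-∀

xyx-exponent : ∀ {A : Set} → DecidableEquality A → ∀ M (x y : List A) → 1 ≤ length x →
  length y ≤ M * length x → ExponentAtLeast (ℤ.+ (M + 2) / suc M) (x ++ y ++ x)
xyx-exponent _≟ₐ_ M x y x≥1 y≤ with least (IsPeriod? _≟ₐ_ (x ++ y ++ x)) (xyx-period x y x≥1)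
... | suc p , period , shortest =
  ℕ.≤-trans x≥1 (ℕ.≤-trans (ℕ.m≤m+n _ _) (ℕ.≤-reflexive (sym (length-++ x)))) ,
  p , (period , shortest) ,
  fraction-≤ (M + 2) M (length (x ++ y ++ x)) p
    (subst (λ l → (M + 2) * suc p ≤ l * suc M) (sym (length-xyx x y))
      (xyx-exponent-arith M (length x) (length y) (suc p) p≤ y≤))
  where
  p≤ : suc p ≤ length x + length y
  p≤ = ℕ.≮⇒≥ (λ longer → shortest _ longer (xyx-period x y x≥1))

BorderedFactor : ∀ {A : Set} → ℕ → List A → Set
BorderedFactor {A} M w = Σ (List A) λ x → Σ (List A) λ y →
  Factor (x ++ y ++ x) w × 1 ≤ length x × length y ≤ M * length x

bordered⇒¬free : ∀ {A : Set} → DecidableEquality A → ∀ M {w : List A} →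
  BorderedFactor M w → ¬ Free (ℤ.+ (M + 2) / suc M) w
bordered⇒¬free _≟ₐ_ M (x , y , xyx⊆w , x≥1 , y≤) free = free (x ++ y ++ x) xyx⊆w (xyx-exponent _≟ₐ_ M x y x≥1 y≤)

count≥2⇒xyx-factor : ∀ X u → 2 ≤ count X u → ∃ λ v → Factor (X ∷ v ++ X ∷ []) u
count≥2⇒xyx-factor X u twice with split-first X u (ℕ.≤-trans (s≤s z≤n) twice)
... | s , t , refl , _ , count≡ with split-first X t (ℕ.≤-pred (subst (2 ≤_) count≡ twice))
...   | v , t′ , refl , _ , _ = v , s , t′ , cong (λ z → s ++ X ∷ z) (++-assoc v (X ∷ []) t′)

length-applyM≤ : ∀ {A : Set} (h : Morphism A) v a → (∀ {Y} → Y ∈ v → length (toList (h Y)) ≤ a) →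
  length (applyM h v) ≤ length v * a
length-applyM≤ h [] a short = z≤n
length-applyM≤ h (Y ∷ v) a short = ℕ.≤-trans (ℕ.≤-reflexive (length-++ (toList (h Y))))
  (ℕ.+-mono-≤ (short (here refl)) (length-applyM≤ h v a (short ∘ there)))

maxFragmentLength : Formula → ℕ
maxFragmentLength g = max 0 (map (length ∘ toList) (fragments g))

≤maxFragmentLength : ∀ g {φ} → φ ∈ fragments g → length (toList φ) ≤ maxFragmentLength g
≤maxFragmentLength g φ∈ = All.lookup (xs≤max 0 _) (∈-map⁺ (length ∘ toList) φ∈)

∈-variables : ∀ {g φ Y} → φ ∈ fragments g → Y ∈ toList φ → Y ∈ concatMap toList (fragments g)
∈-variables φ∈ Y∈ = ∈-concat⁺′ Y∈ (∈-map⁺ toList φ∈)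

variables-occur : ∀ {g Y} → Y ∈ concatMap toList (fragments g) → OccursIn Y g
variables-occur {g} Y∈ with ∈-concat⁻′ (map toList (fragments g)) Y∈
... | u , Y∈u , u∈ with ∈-map⁻ toList u∈
...   | φ , φ∈ , refl = φ , φ∈ , Y∈u

longest-image : ∀ {A : Set} (h : Morphism A) g → ∃ λ X → OccursIn X g ×
  (∀ {φ Y} → φ ∈ fragments g → Y ∈ toList φ → length (toList (h Y)) ≤ length (toList (h X)))
longest-image h g@((X₀ List⁺.∷ Xs) List⁺.∷ φs) = X , variables-occur X∈ , longest
  where
  ∣h∣ : Var → ℕ
  ∣h∣ = length ∘ toList ∘ h
  rest = Xs ++ concatMap toList φs
  X = argmax ∣h∣ X₀ rest
  X∈ : X ∈ concatMap toList (fragments g)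
  X∈ with argmax-sel ∣h∣ X₀ rest
  ... | inj₁ X≡X₀ = here X≡X₀
  ... | inj₂ X∈rest = there X∈rest
  longest : ∀ {φ Y} → φ ∈ fragments g → Y ∈ toList φ → ∣h∣ Y ≤ ∣h∣ X
  longest φ∈ Y∈ with ∈-variables {g} φ∈ Y∈
  ... | here refl = f[⊥]≤f[argmax] {f = ∣h∣} X₀ rest
  ... | there Y∈rest = All.lookup (f[xs]≤f[argmax] {f = ∣h∣} X₀ rest) Y∈rest

nice-occurrence⇒bordered : ∀ {A : Set} g → Nice g → (h : Morphism A) (w : List A) →
  (∀ φ → φ ∈ fragments g → Factor (applyM h (toList φ)) w) → BorderedFactor (maxFragmentLength g) w
nice-occurrence⇒bordered g nice h w occurs with longest-image h g
... | X , X-occurs , longest with nice X X-occurs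
...   | φ , φ∈ , twice with count≥2⇒xyx-factor X (toList φ) twice
...     | v , xvx⊆φ = x , applyM h v , Factor-trans xyx⊆hφ (occurs φ φ∈) , s≤s z≤n , y≤
  where
  x = toList (h X)
  xyx⊆hφ : Factor (x ++ applyM h v ++ x) (applyM h (toList φ))
  xyx⊆hφ = subst (λ z → Factor z (applyM h (toList φ)))
    (cong (x ++_) (trans (applyM-++ h v (X ∷ [])) (cong (applyM h v ++_) (++-identityʳ x))))
    (Factor-applyM h xvx⊆φ)
  v≤M : length v ≤ maxFragmentLength g
  v≤M = ℕ.≤-trans (ℕ.≤-trans (length-++-≤ˡ v) (ℕ.n≤1+n _))
                  (ℕ.≤-trans (Factor-length xvx⊆φ) (≤maxFragmentLength g φ∈))
  y≤ : length (applyM h v) ≤ maxFragmentLength g * length x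
  y≤ = ℕ.≤-trans (length-applyM≤ h v (length x) (λ Y∈ → longest φ∈ (Factor-∈ xvx⊆φ (there (∈-++⁺ˡ Y∈)))))
                 (ℕ.*-monoˡ-≤ (length x) v≤M)

toℕ-mod : ∀ {k a} → a < suc k → toℕ (a mod suc k) ≡ a
toℕ-mod a< = trans (Fin.toℕ-fromℕ< _) (m<n⇒m%n≡m a<)

map-toℕ-mod : ∀ {k} {w : List ℕ} → All (_< suc k) w → map toℕ (map (_mod suc k) w) ≡ w
map-toℕ-mod [] = refl
map-toℕ-mod (a< ∷ w<) = cong₂ _∷_ (toℕ-mod a<) (map-toℕ-mod w<)

eliminable⇒occurs-in-free-word : ∀ {f α} → Eliminable (map toList (fragments f)) → 1ℚ ℚ.< α →
  Σ ℕ λ k → Σ (List (Fin k)) λ w → Free α w × Σ (Morphism (Fin k)) (IsOccurrence f w)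
eliminable⇒occurs-in-free-word {f} eliminable 1<α with >1⇒fraction 1<α
... | n , d , d<n , α≤⇒ with Construction.eliminable⇒sparse-occurrence d<n eliminable
...   | w , h , bounded , occurs = suc K , wₖ , free , hₖ , occurrence
  where
  K = max 0 w
  wₖ = map (_mod suc K) w
  hₖ : Morphism (Fin (suc K))
  hₖ = List⁺.map (_mod suc K) ∘ h
  free : Free _ wₖ
  free = bounded⇒free d<n α≤⇒ (BoundedRepetitions-map⁻ toℕ {n} {d}
    (subst (BoundedRepetitions n d) (sym (map-toℕ-mod (<letterBound w))) bounded))
  occurrence : IsOccurrence f wₖ hₖ
  occurrence φ φ∈ = subst (λ v → Factor v wₖ) (sym (applyM-map (_mod suc K) h (toList φ)))
    (Factor-map (_mod suc K) (occurs (∈-map⁺ toList φ∈)))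

≼*⇒≼ : ∀ {g f} → g ≼* map toList (fragments f) → g ≼ f
≼*⇒≼ (h , g≼*) = h , λ φ φ∈ → from-map (g≼* φ φ∈)
  where
  from-map : ∀ {v f} → (∃ λ u → u ∈ map toList f × Factor v u) → ∃ λ ψ → ψ ∈ f × Factor v (toList ψ)
  from-map (u , u∈ , v⊆u) with ∈-map⁻ toList u∈
  ... | ψ , ψ∈ , refl = ψ , ψ∈ , v⊆u

avoidable⇒nice-divisor : ∀ f → AEGreaterThanOne f → Σ Formula λ g → Nice g × g ≼ f
avoidable⇒nice-divisor f (α , 1<α , avoids) with nice-or-eliminable (map toList (fragments f))
... | inj₁ (g , nice , g≼*) = g , nice , ≼*⇒≼ g≼*
... | inj₂ eliminable with eliminable⇒occurs-in-free-word eliminable 1<α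
...   | k , w , free , occurrence = ⊥-elim (avoids k w free occurrence)

≼-occurrence : ∀ {k g f} {w : List (Fin k)} {h : Morphism (Fin k)} → (g≼f : g ≼ f) → IsOccurrence f w h →
  ∀ φ → φ ∈ fragments g → Factor (applyM (h ∘ₘ proj₁ g≼f) (toList φ)) w
≼-occurrence {w = w} {h} (m , g≼f) occurs φ φ∈ with g≼f φ φ∈
... | ψ , ψ∈ , mφ⊆ψ = subst (λ v → Factor v w) (sym (applyM-∘ₘ h m (toList φ)))
  (Factor-trans (Factor-applyM h mφ⊆ψ) (occurs ψ ψ∈))

nice-divisor⇒avoidable : ∀ f → (Σ Formula λ g → Nice g × g ≼ f) → AEGreaterThanOne f
nice-divisor⇒avoidable f (g , nice , g≼f) = ℤ.+ (M + 2) / suc M , 1<α , avoids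
  where
  M = maxFragmentLength g
  1<α : 1ℚ ℚ.< ℤ.+ (M + 2) / suc M
  1<α = fraction-< 1 0 (M + 2) M (subst₂ _<_ (sym (ℕ.*-identityˡ (suc M))) (sym (ℕ.*-identityʳ (M + 2)))
    (subst (suc M <_) (ℕ.+-comm 2 M) (ℕ.n<1+n (suc M))))
  avoids : ∀ k (w : List (Fin k)) → Free (ℤ.+ (M + 2) / suc M) w → Avoids w f
  avoids k w free (h , occurs) =
    bordered⇒¬free Fin._≟_ M (nice-occurrence⇒bordered g nice (h ∘ₘ proj₁ g≼f) w (≼-occurrence g≼f occurs)) free

theorem7 : (f : Formula) → AEGreaterThanOne f ⇔ (Σ Formula λ g → Nice g × g ≼ f)
theorem7 f = mk⇔ (avoidable⇒nice-divisor f) (nice-divisor⇒avoidable f)
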